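{- Let $0\le m\le n$, let $M=U^m_n$ with ground set $E$, and fix a total order $<$ on $E$. If $\pi$ is an ordered set partition of $E$ that is not a fixed point of $\iota_<$, then $\mathrm{sgn}(\iota_<(\pi))=-\mathrm{sgn}(\pi)$.
   Context: $U^m_n$ is the uniform matroid of rank $m$ on an $n$-element set. An ordered set partition of $E$ is a sequence $\pi=(B_1,\dots,B_j)$ of nonempty pairwise disjoint subsets with union $E$; $\mathrm{sgn}(\pi)$ is $-$ if $\pi$ has an odd number of parts and $+$ if it has an even number of parts. Let $k_i=|B_i|$ and $\ell$ the least integer with $k_1+\cdots+k_\ell\ge m$. The map $\iota_<$: examine the parts $B_1,B_2,\dots$ in order; for the current part $B_i$: (Split) If $|B_i|\ge 2$: if $k_1+\cdots+k_\ell=m$ or $i\ne\ell$, replace $B_i$ by the two consecutive parts $\{x\},\,B_i-\{x\}$ with $x$ the $<$-largest element of $B_i$, leave other parts unchanged, and stop; otherwise move on to the next part. (Merge) If $B_i=\{x\}$: if $i\ne\ell$, $i<j$, and $x>y$ for all $y\in B_{i+1}$, replace $B_i,B_{i+1}$ by the single part $\{x\}\cup B_{i+1}$, leave other parts unchanged, and stop; otherwise move on to the next part. If no part is split or merged, $\iota_<(\pi)=\pi$ ($\pi$ is a fixed point). -}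

module Defs where

open import Level using (0ℓ)
open import Data.Nat using (ℕ; zero; suc; _+_; _∸_; _≤ᵇ_; _≡ᵇ_)
open import Data.Bool using (Bool; true; false; if_then_else_; _∨_; not)
open import Data.Fin using (Fin)
import Data.Fin.Properties as FinP
open import Data.List using (List; []; _∷_; length; concat; filter; map; take)
open import Data.Nat.ListAction using (sum)
open import Data.List.Relation.Unary.All using (All; all?)
open import Data.List.Relation.Unary.Unique.Propositional using (Unique)
open import Data.List.Membership.Propositional using (_∈_)
open import Data.Integer using (ℤ; 1ℤ; -_)
open import Data.Product using (_×_)
open import Relation.Binary.Core using (Rel)
open import Relation.Binary.Structures using (IsStrictTotalOrder)
open import Relation.Binary.PropositionalEquality using (_≡_)
open import Relation.Nullary using (¬_; ¬?)
open import Relation.Nullary.Decidable using (does)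

NonEmpty : {A : Set} → List A → Set
NonEmpty xs = ¬ (xs ≡ [])

IsOSP : (n : ℕ) → List (List (Fin n)) → Set
IsOSP n π = All NonEmpty π × Unique (concat π) × (∀ (e : Fin n) → e ∈ concat π)

sgn : {A : Set} → List A → ℤ
sgn []      = 1ℤ
sgn (_ ∷ π) = - sgn π

-- ℓ = least integer ℓ ≥ 0 with k₁ + ⋯ + k_ℓ ≥ m (ℓ = 0 when m = 0).
ell : ℕ → List ℕ → ℕ
ell zero    _        = 0
ell (suc m) []       = 0   -- unreachable when m ≤ n
ell (suc m) (k ∷ ks) = if suc m ≤ᵇ k then 1 else suc (ell (suc m ∸ k) ks)

module Involution {n : ℕ} (_<_ : Rel (Fin n) 0ℓ)
                  (sto : IsStrictTotalOrder _≡_ _<_) where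
  open IsStrictTotalOrder sto using (_<?_)

  maxFrom : Fin n → List (Fin n) → Fin n
  maxFrom x []       = x
  maxFrom x (y ∷ ys) = if does (x <? y) then maxFrom y ys else maxFrom x ys

  remove : Fin n → List (Fin n) → List (Fin n)
  remove x = filter (λ y → ¬? (y FinP.≟ x))

  -- ℓ and whether k₁+⋯+k_ℓ = m are fixed; i is the (1-based) index of the current part.
  go : (ℓ : ℕ) → (exact : Bool) → (i : ℕ) → List (List (Fin n)) → List (List (Fin n))
  go ℓ ex i [] = []
  go ℓ ex i ([] ∷ rest) = [] ∷ go ℓ ex (suc i) rest
  go ℓ ex i ((x ∷ []) ∷ []) = (x ∷ []) ∷ []
  go ℓ ex i ((x ∷ []) ∷ (C ∷ rest)) =
    if not (i ≡ᵇ ℓ) Data.Bool.∧ does (all? (λ y → y <? x) C)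
    then (x ∷ C) ∷ rest
    else (x ∷ []) ∷ go ℓ ex (suc i) (C ∷ rest)
  go ℓ ex i ((a ∷ b ∷ bs) ∷ rest) =
    if ex ∨ not (i ≡ᵇ ℓ)
    then (mx ∷ []) ∷ remove mx (a ∷ b ∷ bs) ∷ rest
    else (a ∷ b ∷ bs) ∷ go ℓ ex (suc i) rest
    where mx = maxFrom a (b ∷ bs)

  ι : (m : ℕ) → List (List (Fin n)) → List (List (Fin n))
  ι m π = go ℓ (sum (take ℓ ks) ≡ᵇ m) 1 π
    where ks = map length π
          ℓ  = ell m ks

module Submission where

-- The map ι_< either returns π unchanged or performs exactly one
-- local move: a Split replaces one part by two consecutive parts, a Merge
-- replaces two consecutive parts by one, and every other part is kept.  In
-- both cases the number of parts changes by exactly one, so the sign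
-- sgn = (-1)^(number of parts) flips.  Nothing about m, ℓ, the order <, or
-- the partition property of π is needed for this: the argument works for
-- every value of the parameters of the underlying recursion 'go'.

open import Defs
open import Level using (0ℓ)
open import Data.Nat using (ℕ; _≤_; suc; _≡ᵇ_)
open import Data.Fin using (Fin)
open import Data.List using (List; []; _∷_)
open import Data.Integer using (-_)
open import Data.Integer.Properties using (neg-involutive)
open import Data.Bool using (Bool; true; false; not; _∧_; _∨_)
open import Data.Sum using (_⊎_; inj₁; inj₂)
open import Data.Empty using (⊥-elim)
open import Data.List.Relation.Unary.All using (all?)
open import Relation.Nullary.Decidable using (does)
open import Relation.Binary.Core using (Rel)
open import Relation.Binary.Structures using (IsStrictTotalOrder)
open import Relation.Binary.PropositionalEquality using (_≡_; _≢_; refl; cong; sym)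

FixedOrFlipped : {A : Set} → List A → List A → Set
FixedOrFlipped σ' σ = σ' ≡ σ ⊎ sgn σ' ≡ - sgn σ

prepend-preserves : {A : Set} (B : A) {σ' σ : List A} →
                    FixedOrFlipped σ' σ → FixedOrFlipped (B ∷ σ') (B ∷ σ)
prepend-preserves B (inj₁ σ'≡σ)  = inj₁ (cong (B ∷_) σ'≡σ)
prepend-preserves B (inj₂ sgn-eq) = inj₂ (cong -_ sgn-eq)

split-flips : {A : Set} (X Y B : A) (rest : List A) →
              sgn (X ∷ Y ∷ rest) ≡ - sgn (B ∷ rest)
split-flips X Y B rest = refl

merge-flips : {A : Set} (B X Y : A) (rest : List A) →
              sgn (B ∷ rest) ≡ - sgn (X ∷ Y ∷ rest)
merge-flips B X Y rest = cong -_ (sym (neg-involutive (sgn rest)))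

module _ {n : ℕ} (_<_ : Rel (Fin n) 0ℓ) (sto : IsStrictTotalOrder _≡_ _<_) where
  open Involution _<_ sto
  open IsStrictTotalOrder sto using (_<?_)

  -- Each step of the scan either stops after one Split/Merge (sign flips)
  -- or keeps the current part and recurses on the rest.
  -- (In the Merge clause the recursive call is abstracted alongside the test
  -- so that the termination checker sees it on a structurally smaller list.)
  go-fixed-or-flipped : (ℓ : ℕ) (ex : Bool) (i : ℕ) (π : List (List (Fin n))) →
                        FixedOrFlipped (go ℓ ex i π) π
  go-fixed-or-flipped ℓ ex i [] = inj₁ refl
  go-fixed-or-flipped ℓ ex i ([] ∷ rest) =
    prepend-preserves [] (go-fixed-or-flipped ℓ ex (suc i) rest)
  go-fixed-or-flipped ℓ ex i ((x ∷ []) ∷ []) = inj₁ refl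
  go-fixed-or-flipped ℓ ex i ((x ∷ []) ∷ (C ∷ rest))
    with not (i ≡ᵇ ℓ) ∧ does (all? (λ y → y <? x) C)
       | go-fixed-or-flipped ℓ ex (suc i) (C ∷ rest)
  ... | true  | _        = inj₂ (merge-flips (x ∷ C) (x ∷ []) C rest)
  ... | false | recursed = prepend-preserves (x ∷ []) recursed
  go-fixed-or-flipped ℓ ex i ((a ∷ b ∷ bs) ∷ rest) with ex ∨ not (i ≡ᵇ ℓ)
  ... | true  = inj₂ (split-flips (mx ∷ []) (remove mx B) B rest)
    where B  = a ∷ b ∷ bs
          mx = maxFrom a (b ∷ bs)
  ... | false = prepend-preserves (a ∷ b ∷ bs) (go-fixed-or-flipped ℓ ex (suc i) rest)

  ι-fixed-or-flipped : (m : ℕ) (π : List (List (Fin n))) → FixedOrFlipped (ι m π) π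
  ι-fixed-or-flipped m π = go-fixed-or-flipped _ _ 1 π

lemma3p13 : (m n : ℕ) → m ≤ n →
            (_<_ : Rel (Fin n) 0ℓ) (sto : IsStrictTotalOrder _≡_ _<_) →
            (π : List (List (Fin n))) → IsOSP n π →
            Involution.ι _<_ sto m π ≢ π →
            sgn (Involution.ι _<_ sto m π) ≡ - sgn π
lemma3p13 m n _ _<_ sto π _ not-fixed with ι-fixed-or-flipped _<_ sto m π
... | inj₁ fixed   = ⊥-elim (not-fixed fixed)
... | inj₂ flipped = flipped
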